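{- Let $X,Y,Z$ be finite sets and let $T\subseteq X\times Y\times Z$ be a nonempty relation such that for every $(x,y)\in X\times Y$ there exists $z\in Z$ with $(x,y,z)\in T$. Let $x\in\mathbb{N}^{\mathcal{M}(T)}$ be feasible to $\mathbf{PN}(T)$, i.e., there exists $y\in\mathbb{N}^{\Gamma(T)}$ such that $(x,y)$ satisfies constraints (i) and (ii) of $\mathbf{PN}(T)$. Let $\mathcal{M}_x=\{R\in\mathcal{M}(T): x_R=1\}$. Then $\mathcal{M}_x$ is a set of pairwise disjoint monochromatic rectangles which recursively partitions $M_T$.
   Context: The communication matrix $M_T$ has rows indexed by $X$ and columns by $Y$; its cell set is $C_T=X\times Y$. A rectangle is a nonempty product $X'\times Y'\subseteq X\times Y$ (with $X',Y'$ nonempty); $\mathcal{R}(T)$ denotes the set of all rectangles and $\mathcal{R}^{\ast}(T)=\mathcal{R}(T)\setminus\{C_T\}$. A rectangle $X'\times Y'$ is monochromatic if there is $z\in Z$ with $(x,y,z)\in T$ for all $(x,y)\in X'\times Y'$; $\mathcal{M}(T)$ denotes the set of monochromatic rectangles. A partition of a rectangle $X'\times Y'$ is an unordered pair of rectangles $\{X'_1\times Y',X'_2\times Y'\}$ with $X'=X'_1\cup X'_2$, $X'_1\cap X'_2=\emptyset$, or $\{X'\times Y'_1,X'\times Y'_2\}$ with $Y'=Y'_1\cup Y'_2$, $Y'_1\cap Y'_2=\emptyset$; $\mathcal{P}(R)$ is the set of partitions of $R$, and for $P\in\mathcal{P}(R)$ we write $V\in P$ if $V$ is one of the two rectangles of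 $P$. Let $\Gamma(T)=\{(R,P): R\in\mathcal{R}(T),\ P\in\mathcal{P}(R)\}$. A set $\mathcal{R}$ of pairwise disjoint rectangles recursively partitions $M_T$ if its union is $C_T$ and there is a rooted binary tree whose vertices correspond to rectangles, whose root corresponds to $C_T$, whose leaves correspond exactly to the rectangles of $\mathcal{R}$, and such that for each non-leaf vertex the rectangles of its two children form a partition of the rectangle of that vertex. The integer program $\mathbf{PN}(T)$ has variables $x\in\mathbb{N}^{\mathcal{M}(T)}$, $y\in\mathbb{N}^{\Gamma(T)}$ ($\mathbb{N}$ the nonnegative integers) and asks to minimize $\sum_{R\in\mathcal{M}(T)}x_R$ subject to (i) $\sum_{R\in\mathcal{M}(T):\,c\in R}x_R=1$ for every $c\in C_T$, and (ii) for every $R\in\mathcal{R}^{\ast}(T)$: $\sum_{V\in\mathcal{R}(T)}\sum_{P\in\mathcal{P}(V):\,R\in P}y_{V,P}=\sum_{P\in\mathcal{P}(R)}y_{R,P}+x_R$ if $R\in\mathcal{M}(T)$, and $=\sum_{P\in\mathcal{P}(R)}y_{R,P}$ otherwise. -}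

module Defs where

open import Data.Nat using (ℕ; zero; suc; _+_; _*_; _^_; _<_; _<?_)
open import Data.Bool using (Bool; true; false; if_then_else_)
open import Data.Bool.Properties using () renaming (_≟_ to _≟ᴮ_)
open import Data.Fin using (Fin)
open import Data.Fin.Subset using (Subset; _∈_; _∪_; _∩_; ⊤; ⊥; Nonempty)
open import Data.Fin.Subset.Properties using (_∈?_; nonempty?)
open import Data.Fin.Properties using (any?; all?)
open import Data.Vec using (Vec; []; _∷_)
import Data.Vec.Properties as VecP
open import Data.List using (List; []; _∷_; map; filter; cartesianProduct; concatMap)
open import Data.Nat.ListAction using (sum)
open import Data.Product using (Σ; ∃; _×_; _,_)
open import Data.Sum using (_⊎_)
open import Relation.Nullary using (¬_; Dec; yes; no)
open import Relation.Nullary.Decidable using (_×-dec_; _⊎-dec_; _→-dec_)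
open import Relation.Binary.PropositionalEquality using (_≡_; _≢_)

-- Setting.  The finite sets X, Y, Z are Fin nx, Fin ny, Fin nz.
-- A relation T ⊆ X × Y × Z is given by its characteristic function:
-- (x , y , z) ∈ T  iff  T x y z ≡ true.

Rel3 : ℕ → ℕ → ℕ → Set
Rel3 nx ny nz = Fin nx → Fin ny → Fin nz → Bool

Cell : ℕ → ℕ → Set
Cell nx ny = Fin nx × Fin ny

Rect : ℕ → ℕ → Set
Rect nx ny = Subset nx × Subset ny

IsRect : ∀ {nx ny} → Rect nx ny → Set
IsRect (A , B) = Nonempty A × Nonempty B

_∈ᶜ_ : ∀ {nx ny} → Cell nx ny → Rect nx ny → Set
(x , y) ∈ᶜ (A , B) = x ∈ A × y ∈ B

Full : ∀ {nx ny} → Rect nx ny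
Full = ⊤ , ⊤

Mono : ∀ {nx ny nz} → Rel3 nx ny nz → Rect nx ny → Set
Mono {nz = nz} T (A , B) =
  Σ (Fin nz) λ z → ∀ x y → x ∈ A → y ∈ B → T x y z ≡ true

IsMonoRect : ∀ {nx ny nz} → Rel3 nx ny nz → Rect nx ny → Set
IsMonoRect T R = IsRect R × Mono T R

IsPartition : ∀ {nx ny} → Rect nx ny → Rect nx ny → Rect nx ny → Set
IsPartition (A , B) (A₁ , B₁) (A₂ , B₂) =
    (B₁ ≡ B × B₂ ≡ B × A₁ ∪ A₂ ≡ A × A₁ ∩ A₂ ≡ ⊥)
  ⊎ (A₁ ≡ A × A₂ ≡ A × B₁ ∪ B₂ ≡ B × B₁ ∩ B₂ ≡ ⊥)

_≟ˢ_ : ∀ {n} (p q : Subset n) → Dec (p ≡ q)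
_≟ˢ_ = VecP.≡-dec _≟ᴮ_

isRect? : ∀ {nx ny} (R : Rect nx ny) → Dec (IsRect R)
isRect? (A , B) = nonempty? A ×-dec nonempty? B

mono? : ∀ {nx ny nz} (T : Rel3 nx ny nz) (R : Rect nx ny) → Dec (Mono T R)
mono? T (A , B) =
  any? λ z → all? λ x → all? λ y →
    (x ∈? A) →-dec (y ∈? B) →-dec (T x y z ≟ᴮ true)

isMonoRect? : ∀ {nx ny nz} (T : Rel3 nx ny nz) (R : Rect nx ny) → Dec (IsMonoRect T R)
isMonoRect? T R = isRect? R ×-dec mono? T R

cell? : ∀ {nx ny} (c : Cell nx ny) (R : Rect nx ny) → Dec (c ∈ᶜ R)
cell? (x , y) (A , B) = (x ∈? A) ×-dec (y ∈? B)

isPartition? : ∀ {nx ny} (R V W : Rect nx ny) → Dec (IsPartition R V W)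
isPartition? (A , B) (A₁ , B₁) (A₂ , B₂) =
     ((B₁ ≟ˢ B) ×-dec (B₂ ≟ˢ B) ×-dec ((A₁ ∪ A₂) ≟ˢ A) ×-dec ((A₁ ∩ A₂) ≟ˢ ⊥))
  ⊎-dec ((A₁ ≟ˢ A) ×-dec (A₂ ≟ˢ A) ×-dec ((B₁ ∪ B₂) ≟ˢ B) ×-dec ((B₁ ∩ B₂) ≟ˢ ⊥))

allSubsets : (n : ℕ) → List (Subset n)
allSubsets zero    = [] ∷ []
allSubsets (suc n) = concatMap (λ s → (false ∷ s) ∷ (true ∷ s) ∷ []) (allSubsets n)

rects : (nx ny : ℕ) → List (Rect nx ny)
rects nx ny = filter isRect? (cartesianProduct (allSubsets nx) (allSubsets ny))

monoRects : ∀ {nx ny nz} → Rel3 nx ny nz → List (Rect nx ny)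
monoRects {nx} {ny} T = filter (mono? T) (rects nx ny)

∑ : ∀ {A : Set} → List A → (A → ℕ) → ℕ
∑ l f = sum (map f l)

-- An injective numeric code of candidate rectangles, used only to pick a
-- canonical ordered representative (V , W) with code V < code W of each
-- unordered pair {V , W}.
bits : ∀ {n} → Subset n → ℕ
bits []      = 0
bits (b ∷ s) = (if b then 1 else 0) + 2 * bits s

code : ∀ {nx ny} → Rect nx ny → ℕ
code {ny = ny} (A , B) = bits A * 2 ^ ny + bits B

-- Variables y ∈ ℕ^Γ(T): y R V W is the value y_{R,{V,W}} for the canonical
-- representative (code V < code W); other values of the function are unused.
YVar : ℕ → ℕ → Set
YVar nx ny = Rect nx ny → Rect nx ny → Rect nx ny → ℕ

yAt : ∀ {nx ny} → YVar nx ny → Rect nx ny → Rect nx ny → Rect nx ny → ℕ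
yAt y R V W with code V <? code W
... | yes _ = y R V W
... | no  _ = y R W V

-- Variables x ∈ ℕ^𝓜(T): a function on candidate rectangles whose values
-- outside 𝓜(T) are never used.
XVar : ℕ → ℕ → Set
XVar nx ny = Rect nx ny → ℕ

-- ∑_{V ∈ 𝓡(T)} ∑_{P ∈ 𝓟(V), R ∈ P} y_{V,P}   (P = {R , W})
inflow : ∀ {nx ny} → YVar nx ny → Rect nx ny → ℕ
inflow {nx} {ny} y R =
  ∑ (rects nx ny) λ V → ∑ (filter (isPartition? V R) (rects nx ny)) λ W → yAt y V R W

-- ∑_{P ∈ 𝓟(R)} y_{R,P}   (each unordered P = {V , W} counted once)
outflow : ∀ {nx ny} → YVar nx ny → Rect nx ny → ℕ
outflow {nx} {ny} y R =
  ∑ (filter (λ { (V , W) → (code V <? code W) ×-dec isPartition? R V W })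
            (cartesianProduct (rects nx ny) (rects nx ny)))
    λ { (V , W) → y R V W }

ConstraintI : ∀ {nx ny nz} → Rel3 nx ny nz → XVar nx ny → Set
ConstraintI {nx} {ny} T x =
  ∀ (c : Cell nx ny) → ∑ (filter (cell? c) (monoRects T)) x ≡ 1

ConstraintII : ∀ {nx ny nz} → Rel3 nx ny nz → XVar nx ny → YVar nx ny → Set
ConstraintII {nx} {ny} T x y =
  ∀ (R : Rect nx ny) → IsRect R → R ≢ Full →
      (IsMonoRect T R → inflow y R ≡ outflow y R + x R)
    × (¬ IsMonoRect T R → inflow y R ≡ outflow y R)

FeasiblePN : ∀ {nx ny nz} → Rel3 nx ny nz → XVar nx ny → Set
FeasiblePN {nx} {ny} T x =
  Σ (YVar nx ny) λ y → ConstraintI T x × ConstraintII T x y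

Mx : ∀ {nx ny nz} → Rel3 nx ny nz → XVar nx ny → Rect nx ny → Set
Mx T x R = IsMonoRect T R × x R ≡ 1

data PTree {nx ny : ℕ} : Rect nx ny → Set where
  leaf : (R : Rect nx ny) → PTree R
  node : {R : Rect nx ny} (V W : Rect nx ny) → IsRect V → IsRect W →
         IsPartition R V W → PTree V → PTree W → PTree R

Leaf : ∀ {nx ny} {R : Rect nx ny} → PTree R → Rect nx ny → Set
Leaf (leaf R)               S = R ≡ S
Leaf (node V W _ _ _ l r)   S = Leaf l S ⊎ Leaf r S

RecursivelyPartitions : ∀ {nx ny} → (Rect nx ny → Set) → Set
RecursivelyPartitions {nx} {ny} 𝓡 =
    (∀ R → 𝓡 R → IsRect R)
  × (∀ R S → 𝓡 R → 𝓡 S → R ≢ S → ∀ (c : Cell nx ny) → c ∈ᶜ R → c ∈ᶜ S → Data.Empty.⊥)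
  × (∀ (c : Cell nx ny) → ∃ λ R → 𝓡 R × c ∈ᶜ R)
  × Σ (PTree Full) (λ t → ∀ R → (Leaf t R → 𝓡 R) × (𝓡 R → Leaf t R))
  where import Data.Empty

module Submission where

-- Read y as a flow on rectangles: y_{R,{V,W}} sends flow from R to
-- both V and W, and constraint (ii) says that every proper rectangle R
-- receives as much as it passes on, plus x_R if R is monochromatic
-- (the "source" of R).  Call R active if outflow(R) + source(R) > 0.
--   * Constraint (i) forces x_R ≤ 1, and two distinct rectangles of 𝓜_x
--     cannot share a cell (the cell's sum would be ≥ 2).
--   * The full matrix C_T is active: a cell lies in some R with x_R = 1;
--     if R ≠ C_T, following flow upwards from R through strictly larger
--     rectangles must end at C_T with positive outflow.
--   * From an active rectangle a recursive partition into members of 𝓜_x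
--     is built by well-founded recursion on size: either R ∈ 𝓜_x is a leaf,
--     or a partition {V , W} of R carries positive flow, so V and W are
--     active proper rectangles.

open import Defs
open import Data.Nat using (ℕ; zero; suc; _+_; _*_; _^_; _≤_; _<_; z≤n; s≤s; _<?_; NonZero)
open import Data.Nat.Properties
open import Data.Nat.DivMod using (_%_; [m+kn]%n≡m%n; m<n⇒m%n≡m)
open import Data.Fin using (Fin)
open import Data.Bool using (true; false; if_then_else_)
open import Data.Product using (Σ; ∃; ∃₂; _×_; _,_; proj₁; proj₂)
open import Data.Sum using (_⊎_; inj₁; inj₂)
open import Data.Empty using (⊥-elim) renaming (⊥ to Empty)
open import Data.List using (List; []; _∷_; filter; cartesianProduct)
open import Data.Vec using ([]; _∷_)
open import Data.List.Membership.Propositional using () renaming (_∈_ to _∈ˡ_)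
open import Data.List.Membership.Propositional.Properties
  using (∈-filter⁺; ∈-filter⁻; ∈-cartesianProduct⁺; ∈-cartesianProduct⁻; ∈-concatMap⁺)
open import Data.List.Relation.Unary.Any using (here; there)
import Data.List.Relation.Unary.Any as Any
open import Data.Fin.Subset using (Subset; _∈_; _∪_; _∩_; ⊤; ⊥; Nonempty; ∣_∣)
open import Data.Fin.Subset.Properties
  using (∈⊤; ∉⊥; ∪-comm; ∩-comm; ∩-idem; x∈p∪q⁻; x∈p∪q⁺; x∈p∩q⁺; p⊆p∪q;
         ∣p∣≤n; ∣⊤∣≡n; p⊂q⇒∣p∣<∣q∣)
open import Relation.Nullary using (Dec; yes; no)
open import Relation.Binary.PropositionalEquality
open import Relation.Binary.Definitions using (tri<; tri≈; tri>)

positive-term : ∀ {A : Set} (l : List A) (f : A → ℕ) → 0 < ∑ l f →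
                ∃ λ a → a ∈ˡ l × 0 < f a
positive-term (a ∷ l) f pos with f a in fa
... | suc _ = a , here refl , subst (0 <_) (sym fa) (s≤s z≤n)
... | zero  with positive-term l f pos
...   | b , b∈l , fb = b , there b∈l , fb

term≤∑ : ∀ {A : Set} {l : List A} (f : A → ℕ) {a} → a ∈ˡ l → f a ≤ ∑ l f
term≤∑ f (here refl) = m≤m+n _ _
term≤∑ f (there a∈l) = ≤-trans (term≤∑ f a∈l) (m≤n+m _ _)

two-terms≤∑ : ∀ {A : Set} {l : List A} (f : A → ℕ) {a b} →
              a ∈ˡ l → b ∈ˡ l → a ≢ b → f a + f b ≤ ∑ l f
two-terms≤∑ f (here refl) (here refl) a≢b = ⊥-elim (a≢b refl)
two-terms≤∑ f (here refl) (there b∈l) _   = +-monoʳ-≤ _ (term≤∑ f b∈l)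
two-terms≤∑ f {a} {b} (there a∈l) (here refl) _ =
  ≤-trans (≤-reflexive (+-comm (f a) (f b))) (+-monoʳ-≤ (f b) (term≤∑ f a∈l))
two-terms≤∑ f (there a∈l) (there b∈l) a≢b = ≤-trans (two-terms≤∑ f a∈l b∈l a≢b) (m≤n+m _ _)

positive-summand : ∀ {m n} → 0 < m + n → 0 < m ⊎ 0 < n
positive-summand {suc _} _   = inj₁ (s≤s z≤n)
positive-summand {zero}  0<n = inj₂ 0<n

bothExtensions : ∀ {n} → Subset n → List (Subset (suc n))
bothExtensions s = (false ∷ s) ∷ (true ∷ s) ∷ []

allSubsets-complete : ∀ n (s : Subset n) → s ∈ˡ allSubsets n
allSubsets-complete zero    []          = here refl
allSubsets-complete (suc n) (false ∷ s) =
  ∈-concatMap⁺ bothExtensions (Any.map (λ { refl → here refl }) (allSubsets-complete n s))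
allSubsets-complete (suc n) (true ∷ s)  =
  ∈-concatMap⁺ bothExtensions (Any.map (λ { refl → there (here refl) }) (allSubsets-complete n s))


module _ {nx ny : ℕ} where

  rects-complete : ∀ {R : Rect nx ny} → IsRect R → R ∈ˡ rects nx ny
  rects-complete {A , B} r =
    ∈-filter⁺ isRect? (∈-cartesianProduct⁺ (allSubsets-complete _ A) (allSubsets-complete _ B)) r

  rects-sound : ∀ {R : Rect nx ny} → R ∈ˡ rects nx ny → IsRect R
  rects-sound R∈ = proj₂ (∈-filter⁻ isRect? {xs = cartesianProduct (allSubsets nx) (allSubsets ny)} R∈)

  _≟ʳ_ : (R S : Rect nx ny) → Dec (R ≡ S)
  (A , B) ≟ʳ (A' , B') with A ≟ˢ A' | B ≟ˢ B'
  ... | yes refl | yes refl = yes refl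
  ... | no A≢A'  | _        = no λ { refl → A≢A' refl }
  ... | _        | no B≢B'  = no λ { refl → B≢B' refl }

-- Sizes and partitions.  The size |A| + |B| of A × B strictly decreases
-- along partitions; it is the measure for both recursions below.

size : ∀ {nx ny} → Rect nx ny → ℕ
size (A , B) = ∣ A ∣ + ∣ B ∣

size≤ : ∀ {nx ny} (R : Rect nx ny) → size R ≤ nx + ny
size≤ (A , B) = +-mono-≤ (∣p∣≤n A) (∣p∣≤n B)

size-Full : ∀ {nx ny} → size (Full {nx} {ny}) ≡ nx + ny
size-Full {nx} {ny} = cong₂ _+_ (∣⊤∣≡n nx) (∣⊤∣≡n ny)

∣p∣<∣p∪q∣ : ∀ {n} (p q : Subset n) → p ∩ q ≡ ⊥ → Nonempty q → ∣ p ∣ < ∣ p ∪ q ∣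
∣p∣<∣p∪q∣ p q p∩q≡⊥ (i , i∈q) =
  p⊂q⇒∣p∣<∣q∣ (p⊆p∪q q , i , x∈p∪q⁺ (inj₂ i∈q) ,
               λ i∈p → ∉⊥ (subst (i ∈_) p∩q≡⊥ (x∈p∩q⁺ (i∈p , i∈q))))

module _ {nx ny : ℕ} where

  partition-sym : ∀ {R V W : Rect nx ny} → IsPartition R V W → IsPartition R W V
  partition-sym {A , B} {A₁ , B₁} {A₂ , B₂} (inj₁ (e₁ , e₂ , ∪≡ , ∩≡)) =
    inj₁ (e₂ , e₁ , trans (∪-comm A₂ A₁) ∪≡ , trans (∩-comm A₂ A₁) ∩≡)
  partition-sym {A , B} {A₁ , B₁} {A₂ , B₂} (inj₂ (e₁ , e₂ , ∪≡ , ∩≡)) =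
    inj₂ (e₂ , e₁ , trans (∪-comm B₂ B₁) ∪≡ , trans (∩-comm B₂ B₁) ∩≡)

  partition-covers : ∀ {R V W : Rect nx ny} (c : Cell nx ny) → IsPartition R V W →
                     c ∈ᶜ R → c ∈ᶜ V ⊎ c ∈ᶜ W
  partition-covers {_} {A₁ , _} {A₂ , _} (a , b) (inj₁ (refl , refl , refl , _)) (a∈ , b∈)
    with x∈p∪q⁻ A₁ A₂ a∈
  ... | inj₁ a∈A₁ = inj₁ (a∈A₁ , b∈)
  ... | inj₂ a∈A₂ = inj₂ (a∈A₂ , b∈)
  partition-covers {_} {_ , B₁} {_ , B₂} (a , b) (inj₂ (refl , refl , refl , _)) (a∈ , b∈)
    with x∈p∪q⁻ B₁ B₂ b∈
  ... | inj₁ b∈B₁ = inj₁ (a∈ , b∈B₁)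
  ... | inj₂ b∈B₂ = inj₂ (a∈ , b∈B₂)

  partition-distinct : ∀ {R V W : Rect nx ny} → IsRect V → IsPartition R V W → V ≢ W
  partition-distinct {_} {A₁ , _} ((a , a∈) , _) (inj₁ (_ , _ , _ , ∩≡)) refl =
    ∉⊥ (subst (a ∈_) (trans (sym (∩-idem A₁)) ∩≡) a∈)
  partition-distinct {_} {_ , B₁} (_ , (b , b∈)) (inj₂ (_ , _ , _ , ∩≡)) refl =
    ∉⊥ (subst (b ∈_) (trans (sym (∩-idem B₁)) ∩≡) b∈)

  partition-shrinks : ∀ {R V W : Rect nx ny} → IsRect W → IsPartition R V W → size V < size R
  partition-shrinks {_} {A₁ , B₁} {A₂ , _} (neA₂ , _) (inj₁ (refl , refl , refl , ∩≡)) =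
    +-monoˡ-< ∣ B₁ ∣ (∣p∣<∣p∪q∣ A₁ A₂ ∩≡ neA₂)
  partition-shrinks {_} {A₁ , B₁} {_ , B₂} (_ , neB₂) (inj₂ (refl , refl , refl , ∩≡)) =
    +-monoʳ-< ∣ A₁ ∣ (∣p∣<∣p∪q∣ B₁ B₂ ∩≡ neB₂)

  part≢Full : ∀ {R V W : Rect nx ny} → IsRect W → IsPartition R V W → V ≢ Full
  part≢Full {R} rW part refl =
    <-irrefl refl (<-≤-trans (partition-shrinks rW part)
                             (subst (size R ≤_) (sym (size-Full {nx} {ny})) (size≤ R)))

-- Injectivity of code: it makes the ordered representative (V , W) of an
-- unordered partition {V , W} with code V < code W well defined.

bits-injective : ∀ {n} (s t : Subset n) → bits s ≡ bits t → s ≡ t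
bits-injective []          []          _  = refl
bits-injective (false ∷ s) (false ∷ t) eq =
  cong (false ∷_) (bits-injective s t (*-cancelˡ-≡ (bits s) (bits t) 2 eq))
bits-injective (true ∷ s)  (true ∷ t)  eq =
  cong (true ∷_) (bits-injective s t (*-cancelˡ-≡ (bits s) (bits t) 2 (suc-injective eq)))
bits-injective (true ∷ s)  (false ∷ t) eq = ⊥-elim (even≢odd (bits t) (bits s) (sym eq))
bits-injective (false ∷ s) (true ∷ t)  eq = ⊥-elim (even≢odd (bits s) (bits t) eq)

bits< : ∀ {n} (s : Subset n) → bits s < 2 ^ n
bits< []          = s≤s z≤n
bits< {suc n} (b ∷ s) = begin-strict
    (if b then 1 else 0) + 2 * bits s  ≤⟨ +-monoˡ-≤ (2 * bits s) (bit≤1 b) ⟩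
    1 + 2 * bits s                     <⟨ n<1+n _ ⟩
    2 + 2 * bits s                     ≡⟨ sym (*-suc 2 (bits s)) ⟩
    2 * suc (bits s)                   ≤⟨ *-monoʳ-≤ 2 (bits< s) ⟩
    2 * 2 ^ n                          ∎
  where
    open ≤-Reasoning
    bit≤1 : ∀ b → (if b then 1 else 0) ≤ 1
    bit≤1 true  = s≤s z≤n
    bit≤1 false = z≤n

digits-injective : ∀ N .{{_ : NonZero N}} {a a' b b'} → b < N → b' < N →
                   a * N + b ≡ a' * N + b' → a ≡ a' × b ≡ b'
digits-injective N {a} {a'} {b} {b'} b<N b'<N eq = *-cancelʳ-≡ a a' N high , low
  where
    lowDigit : ∀ k d → d < N → (k * N + d) % N ≡ d
    lowDigit k d d<N = trans (cong (_% N) (+-comm (k * N) d))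
                             (trans ([m+kn]%n≡m%n d k N) (m<n⇒m%n≡m d<N))
    low : b ≡ b'
    low = trans (sym (lowDigit a b b<N)) (trans (cong (_% N) eq) (lowDigit a' b' b'<N))
    high : a * N ≡ a' * N
    high = +-cancelʳ-≡ b (a * N) (a' * N) (trans eq (cong (a' * N +_) (sym low)))

code-injective : ∀ {nx ny} (R S : Rect nx ny) → code R ≡ code S → R ≡ S
code-injective {nx} {ny} (A , B) (A' , B') eq
  with digits-injective (2 ^ ny) {{m^n≢0 2 ny}} (bits< B) (bits< B') eq
... | bitsA≡ , bitsB≡ = cong₂ _,_ (bits-injective A A' bitsA≡) (bits-injective B B' bitsB≡)

module Flow {nx ny : ℕ} (y : YVar nx ny) where

  yAt-ordered : ∀ {R V W} → code V < code W → yAt y R V W ≡ y R V W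
  yAt-ordered {R} {V} {W} V<W with code V <? code W
  ... | yes _   = refl
  ... | no V≮W = ⊥-elim (V≮W V<W)

  yAt-reversed : ∀ {R V W} → code V < code W → yAt y R W V ≡ y R V W
  yAt-reversed {R} {V} {W} V<W with code W <? code V
  ... | yes W<V = ⊥-elim (<-asym V<W W<V)
  ... | no _    = refl

  flow≤inflow : ∀ {R V W} → IsRect R → IsRect W → IsPartition R V W →
                yAt y R V W ≤ inflow y V
  flow≤inflow {R} {V} r rW part =
    ≤-trans (term≤∑ (yAt y R V) (∈-filter⁺ (isPartition? R V) (rects-complete rW) part))
            (term≤∑ (λ R' → ∑ (filter (isPartition? R' V) (rects nx ny)) (yAt y R' V))
                    (rects-complete r))

  flow≤outflow : ∀ {R V W} → IsRect V → IsRect W → IsPartition R V W →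
                 yAt y R V W ≤ outflow y R
  flow≤outflow {R} {V} {W} rV rW part with <-cmp (code V) (code W)
  ... | tri< V<W _ _ = ≤-trans (≤-reflexive (yAt-ordered V<W))
        (term≤∑ _ (∈-filter⁺ _ (∈-cartesianProduct⁺ (rects-complete rV) (rects-complete rW))
                                (V<W , part)))
  ... | tri≈ _ V≡W _ = ⊥-elim (partition-distinct rV part (code-injective V W V≡W))
  ... | tri> _ _ W<V = ≤-trans (≤-reflexive (yAt-reversed W<V))
        (term≤∑ _ (∈-filter⁺ _ (∈-cartesianProduct⁺ (rects-complete rW) (rects-complete rV))
                                (W<V , partition-sym part)))

  parent : ∀ {R} → IsRect R → 0 < inflow y R →
           ∃ λ V → IsRect V × size R < size V × 0 < outflow y V
  parent {R} r pos with positive-term (rects nx ny) _ pos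
  ... | V , V∈ , pos₁ with positive-term (filter (isPartition? V R) (rects nx ny)) _ pos₁
  ... | W , W∈ , pos₂ with ∈-filter⁻ (isPartition? V R) W∈
  ... | W∈rects , part =
    V , rects-sound V∈ , partition-shrinks (rects-sound W∈rects) part ,
    <-≤-trans pos₂ (flow≤outflow r (rects-sound W∈rects) part)

  children : ∀ {R} → IsRect R → 0 < outflow y R →
             ∃₂ λ V W → IsRect V × IsRect W × IsPartition R V W
                      × 0 < inflow y V × 0 < inflow y W
  children {R} r pos with positive-term {Rect nx ny × Rect nx ny} _ _ pos
  ... | (V , W) , VW∈ , pos₁
    with ∈-filter⁻ {P = λ p → code (proj₁ p) < code (proj₂ p) × IsPartition R (proj₁ p) (proj₂ p)}
                   _ VW∈
  ... | VW∈rects , V<W , part with ∈-cartesianProduct⁻ (rects nx ny) (rects nx ny) VW∈rects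
  ... | V∈ , W∈ =
    V , W , rV , rW , part ,
    <-≤-trans (subst (0 <_) (sym (yAt-ordered V<W)) pos₁) (flow≤inflow r rW part) ,
    <-≤-trans (subst (0 <_) (sym (yAt-reversed V<W)) pos₁)
              (flow≤inflow r rV (partition-sym part))
    where
      rV = rects-sound V∈
      rW = rects-sound W∈

module Feasible {nx ny nz : ℕ} (T : Rel3 nx ny nz) (x : XVar nx ny) (y : YVar nx ny)
  (cI : ConstraintI T x) (cII : ConstraintII T x y) where

  open Flow y

  mono∈cellList : ∀ {R} (c : Cell nx ny) → IsMonoRect T R → c ∈ᶜ R →
                  R ∈ˡ filter (cell? c) (monoRects T)
  mono∈cellList c (r , m) c∈R = ∈-filter⁺ (cell? c) (∈-filter⁺ (mono? T) (rects-complete r) m) c∈R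

  x≤1 : ∀ {R} → IsMonoRect T R → x R ≤ 1
  x≤1 {A , B} m@(((a , a∈) , (b , b∈)) , _) =
    subst (x (A , B) ≤_) (cI (a , b)) (term≤∑ x (mono∈cellList (a , b) m (a∈ , b∈)))

  Mx-disjoint : ∀ R S → Mx T x R → Mx T x S → R ≢ S →
                ∀ (c : Cell nx ny) → c ∈ᶜ R → c ∈ᶜ S → Empty
  Mx-disjoint R S (mR , xR≡1) (mS , xS≡1) R≢S c c∈R c∈S =
    <-irrefl refl (subst₂ _≤_ (cong₂ _+_ xR≡1 xS≡1) (cI c)
      (two-terms≤∑ x (mono∈cellList c mR c∈R) (mono∈cellList c mS c∈S) R≢S))

  selected-exists : Cell nx ny → ∃ λ R → IsMonoRect T R × 0 < x R
  selected-exists c with positive-term (filter (cell? c) (monoRects T)) x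
                           (subst (0 <_) (sym (cI c)) (s≤s z≤n))
  ... | R , R∈ , xR>0 with ∈-filter⁻ (mono? T) (proj₁ (∈-filter⁻ (cell? c) R∈))
  ... | R∈rects , mono = R , (rects-sound R∈rects , mono) , xR>0

  source : Rect nx ny → ℕ
  source R with isMonoRect? T R
  ... | yes _ = x R
  ... | no  _ = 0

  source-mono : ∀ {R} → IsMonoRect T R → source R ≡ x R
  source-mono {R} m with isMonoRect? T R
  ... | yes _ = refl
  ... | no ¬m = ⊥-elim (¬m m)

  source-positive : ∀ {R} → 0 < source R → Mx T x R
  source-positive {R} pos with isMonoRect? T R
  ... | yes m = m , ≤-antisym (x≤1 m) pos

  conservation : ∀ {R} → IsRect R → R ≢ Full → inflow y R ≡ outflow y R + source R
  conservation {R} r R≢Full with isMonoRect? T R | cII R r R≢Full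
  ... | yes m | (withX , _)    = withX m
  ... | no ¬m | (_ , withoutX) = trans (withoutX ¬m) (sym (+-identityʳ _))

  Active : Rect nx ny → Set
  Active R = 0 < outflow y R + source R

  active⇒inflow : ∀ {R} → IsRect R → R ≢ Full → Active R → 0 < inflow y R
  active⇒inflow r R≢Full act = subst (0 <_) (sym (conservation r R≢Full)) act

  inflow⇒active : ∀ {R} → IsRect R → R ≢ Full → 0 < inflow y R → Active R
  inflow⇒active r R≢Full pos = subst (0 <_) (conservation r R≢Full) pos

  -- Flow entering a proper rectangle R climbs through ever larger
  -- rectangles, which can only stop at the whole matrix.  The fuel k bounds
  -- the remaining growth of size.
  climb : ∀ k {R} → IsRect R → R ≢ Full → 0 < inflow y R → nx + ny ≤ size R + k →
          0 < outflow y Full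
  climb k r R≢Full pos bound with parent r pos
  ... | V , rV , R<V , outV with V ≟ʳ Full
  ... | yes refl = outV
  ... | no V≢Full with k
  ...   | zero = ⊥-elim (<-irrefl refl
                   (<-≤-trans R<V (≤-trans (size≤ V) (subst (nx + ny ≤_) (+-identityʳ _) bound))))
  ...   | suc k' = climb k' rV V≢Full
                     (active⇒inflow rV V≢Full (<-≤-trans outV (m≤m+n _ _)))
                     (≤-trans bound (≤-trans (≤-reflexive (+-suc _ k')) (+-monoˡ-≤ k' R<V)))

  mono-active : ∀ {R} → IsMonoRect T R → 0 < x R → Active R
  mono-active m xR>0 = <-≤-trans (subst (0 <_) (sym (source-mono m)) xR>0) (m≤n+m _ _)

  -- The whole matrix is active (given one cell): either it is itself the
  -- selected rectangle, or flow out of a selected rectangle climbs to it.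
  Full-active : Cell nx ny → Active Full
  Full-active c with selected-exists c
  ... | R , m , xR>0 with R ≟ʳ Full
  ... | yes refl  = mono-active m xR>0
  ... | no R≢Full =
    <-≤-trans (climb (nx + ny) (proj₁ m) R≢Full
                     (active⇒inflow (proj₁ m) R≢Full (mono-active m xR>0))
                     (m≤n+m (nx + ny) (size R)))
              (m≤m+n _ _)

  record Tiling (R : Rect nx ny) : Set where
    field
      tree   : PTree R
      leafMx : ∀ S → Leaf tree S → Mx T x S
      covers : ∀ (c : Cell nx ny) → c ∈ᶜ R → ∃ λ S → Leaf tree S × c ∈ᶜ S
  open Tiling

  leafTiling : ∀ {R} → Mx T x R → Tiling R
  leafTiling {R} mx = record
    { tree = leaf R ; leafMx = λ { S refl → mx } ; covers = λ c c∈R → R , refl , c∈R }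

  nodeTiling : ∀ {R V W} (rV : IsRect V) (rW : IsRect W) (part : IsPartition R V W) →
               Tiling V → Tiling W → Tiling R
  nodeTiling {R} {V} {W} rV rW part tV tW = record
    { tree   = node V W rV rW part (tree tV) (tree tW)
    ; leafMx = λ { S (inj₁ l) → leafMx tV S l ; S (inj₂ l) → leafMx tW S l }
    ; covers = λ c c∈R → inPart c (partition-covers c part c∈R)
    }
    where
      inPart : ∀ c → c ∈ᶜ V ⊎ c ∈ᶜ W →
               ∃ λ S → Leaf (node V W rV rW part (tree tV) (tree tW)) S × c ∈ᶜ S
      inPart c (inj₁ c∈V) with covers tV c c∈V
      ... | S , l , c∈S = S , inj₁ l , c∈S
      inPart c (inj₂ c∈W) with covers tW c c∈W
      ... | S , l , c∈S = S , inj₂ l , c∈S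

  tile : ∀ k {R} → size R < k → IsRect R → Active R → Tiling R
  tile zero    () _ _
  tile (suc k) {R} bound r act with positive-summand {outflow y R} act
  ... | inj₂ src>0 = leafTiling (source-positive src>0)
  ... | inj₁ out>0 with children r out>0
  ... | V , W , rV , rW , part , inV , inW =
    nodeTiling rV rW part
      (tile k (<-≤-trans (partition-shrinks rW part) (≤-pred bound)) rV
            (inflow⇒active rV (part≢Full rW part) inV))
      (tile k (<-≤-trans (partition-shrinks rV (partition-sym part)) (≤-pred bound)) rW
            (inflow⇒active rW (part≢Full rV (partition-sym part)) inW))

  -- In a tiling of the whole matrix every member of 𝓜_x is a leaf: it
  -- meets the leaf covering one of its cells, and members are disjoint.
  Mx⇒leaf : (t : Tiling Full) → ∀ S → Mx T x S → Leaf (tree t) S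
  Mx⇒leaf t S mx@((((a , a∈) , (b , b∈)) , _) , _) with covers t (a , b) (∈⊤ , ∈⊤)
  ... | S' , l , c∈S' with S' ≟ʳ S
  ... | yes refl = l
  ... | no S'≢S  = ⊥-elim (Mx-disjoint S' S (leafMx t S' l) mx S'≢S (a , b) c∈S' (a∈ , b∈))

lemma2 : ∀ {nx ny nz : ℕ} (T : Rel3 nx ny nz) →
    -- T is nonempty
    Σ (Fin nx) (λ a → Σ (Fin ny) (λ b → Σ (Fin nz) (λ c → T a b c ≡ true))) →
    -- every (x , y) has some z with (x , y , z) ∈ T
    (∀ a b → Σ (Fin nz) (λ c → T a b c ≡ true)) →
    (x : XVar nx ny) → FeasiblePN T x →
    (∀ R → Mx T x R → IsMonoRect T R) × RecursivelyPartitions (Mx T x)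
lemma2 {nx} {ny} T (a , b , _) _ x (y , cI , cII) =
  (λ _ → proj₁) , (λ _ mx → proj₁ (proj₁ mx)) , Mx-disjoint , cover ,
  (tree whole , λ S → leafMx whole S , Mx⇒leaf whole S)
  where
    open Feasible T x y cI cII
    open Tiling
    Full-rect : IsRect (Full {nx} {ny})
    Full-rect = (a , ∈⊤) , (b , ∈⊤)
    whole : Tiling Full
    whole = tile (suc (size (Full {nx} {ny}))) ≤-refl Full-rect (Full-active (a , b))
    cover : ∀ (c : Cell nx ny) → ∃ λ R → Mx T x R × c ∈ᶜ R
    cover c with covers whole c (∈⊤ , ∈⊤)
    ... | S , l , c∈S = S , leafMx whole S l , c∈S
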